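{- Let $u,v,w\ge0$ be integers and $L=u+v+w$. Consider walks on $\mathbb Z^3$ starting at $(u,v,w)$ with steps in $\Omega_2=\Omega_2'\cup\Omega_2''$, where $\Omega_2'=\{(1,0,-1),(-1,1,0),(0,-1,1)\}$ and $\Omega_2''=\{(1,-1,0),(-1,0,1),(0,1,-1)\}$, that stay in the non-negative orthant $(\mathbb N_0)^3$ (so they stay on the triangular domain $\{(n_x,n_y,n_z)\in(\mathbb N_0)^3:n_x+n_y+n_z=L\}$). Give each step in $\Omega_2'$ weight $\alpha$ and each step in $\Omega_2''$ weight $\beta$, and let $$G(t)=\sum_{\text{walks }\omega}\alpha^{\#\{\text{steps of }\omega\text{ in }\Omega_2'\}}\beta^{\#\{\text{steps of }\omega\text{ in }\Omega_2''\}}t^{|\omega|},$$ the sum over all such walks (of any length $|\omega|\ge0$, with arbitrary endpoint). Then $$G(t)=\frac{(1-p^3)(1-p^{u+1})(1-p^{v+1})(1-p^{w+1})}{(1-p)^3(1-p^{u+v+w+3})},$$ where $p=(\alpha+\beta)t\,M((\alpha+\beta)t)$ and $M(s)=\dfrac{1-s-\sqrt{(1+s)(1-3s)}}{2s^2}$ is the generating function of Motzkin paths.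
   Context: $\alpha,\beta$ are indeterminates (weights); the identity is one of formal power series in $t$. The series $p$ has zero constant term and satisfies $1=(\alpha+\beta)t(p+1+1/p)$. -}

module Defs where

open import Level using (Level)
open import Algebra.Bundles using (CommutativeRing)
open import Data.Nat using (ℕ; zero; suc; _∸_)
open import Data.Integer using (ℤ; 0ℤ; _≤?_) renaming (_+_ to _+ℤ_; -_ to -ℤ_; +_ to ℤ⁺)
open import Data.Bool using (Bool; true; false; _∧_; if_then_else_)
open import Data.List using (List; []; _∷_; map; concatMap; foldr; zipWith; length)
open import Data.Product using (_×_; _,_)
open import Relation.Nullary.Decidable using (⌊_⌋)

data Step : Set where
  a₁ a₂ a₃ : Step
  b₁ b₂ b₃ : Step

allSteps : List Step
allSteps = a₁ ∷ a₂ ∷ a₃ ∷ b₁ ∷ b₂ ∷ b₃ ∷ []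

Point : Set
Point = ℤ × ℤ × ℤ

one₋ : ℤ
one₋ = -ℤ (ℤ⁺ 1)

vec : Step → Point
vec a₁ = (ℤ⁺ 1 , ℤ⁺ 0 , one₋)
vec a₂ = (one₋ , ℤ⁺ 1 , ℤ⁺ 0)
vec a₃ = (ℤ⁺ 0 , one₋ , ℤ⁺ 1)
vec b₁ = (ℤ⁺ 1 , one₋ , ℤ⁺ 0)
vec b₂ = (one₋ , ℤ⁺ 0 , ℤ⁺ 1)
vec b₃ = (ℤ⁺ 0 , ℤ⁺ 1 , one₋)

move : Point → Step → Point
move (x , y , z) s with vec s
... | (dx , dy , dz) = (x +ℤ dx , y +ℤ dy , z +ℤ dz)

inOrthant : Point → Bool
inOrthant (x , y , z) = ⌊ 0ℤ ≤? x ⌋ ∧ ⌊ 0ℤ ≤? y ⌋ ∧ ⌊ 0ℤ ≤? z ⌋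

stays : Point → List Step → Bool
stays q [] = inOrthant q
stays q (s ∷ ss) = inOrthant q ∧ stays (move q s) ss

walksOfLength : ℕ → List (List Step)
walksOfLength zero = [] ∷ []
walksOfLength (suc n) = concatMap (λ s → map (s ∷_) (walksOfLength n)) allSteps

module _ {c ℓ : Level} (R : CommutativeRing c ℓ) where
  open CommutativeRing R

  Series : Set c
  Series = ℕ → Carrier

  sumBelow : (ℕ → Carrier) → ℕ → Carrier
  sumBelow f zero = 0#
  sumBelow f (suc n) = sumBelow f n + f n

  sumList : List Carrier → Carrier
  sumList = foldr _+_ 0#

  prodList : List Carrier → Carrier
  prodList = foldr _*_ 1#

  oneS : Series
  oneS zero = 1#
  oneS (suc n) = 0#

  tS : Series
  tS (suc zero) = 1#
  tS _ = 0#

  constS : Carrier → Series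
  constS a zero = a
  constS a (suc n) = 0#

  _⊕_ : Series → Series → Series
  (f ⊕ g) n = f n + g n

  _⊖_ : Series → Series → Series
  (f ⊖ g) n = f n - g n

  _⊛_ : Series → Series → Series
  (f ⊛ g) n = sumBelow (λ k → f k * g (n ∸ k)) (suc n)

  powS : Series → ℕ → Series
  powS f zero = oneS
  powS f (suc k) = f ⊛ powS f k

  -- Multiplicative inverse of a series f with f 0 ≈ 1:
  -- b 0 = 1,  b n = - Σ_{k=1}^{n} f k * b (n - k).
  -- invList f n = [b n , b (n-1) , … , b 0]
  invList : Series → ℕ → List Carrier
  invList f zero = 1# ∷ []
  invList f (suc n) =
    let bs = invList f n
        fs = map (λ k → f (suc k)) (Data.List.upTo (suc n))
    in (- sumList (zipWith _*_ fs bs)) ∷ bs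

  invS : Series → Series
  invS f n with invList f n
  ... | [] = 0#
  ... | b ∷ _ = b

  weight : Carrier → Carrier → Step → Carrier
  weight α β a₁ = α
  weight α β a₂ = α
  weight α β a₃ = α
  weight α β b₁ = β
  weight α β b₂ = β
  weight α β b₃ = β

  Gcoeff : Carrier → Carrier → ℕ → ℕ → ℕ → Series
  Gcoeff α β u v w n =
    sumList (map (λ ω → if stays (ℤ⁺ u , ℤ⁺ v , ℤ⁺ w) ω
                          then prodList (map (weight α β) ω) else 0#)
                 (walksOfLength n))

  -- p has zero constant term and p = (α+β) t (1 + p + p²),
  -- i.e. 1 = (α+β) t (p + 1 + 1/p).
  IsP : Carrier → Carrier → Series → Set ℓ
  IsP α β p = (p 0 ≈ 0#) ×
    (∀ n → p n ≈ ((constS (α + β) ⊛ tS) ⊛ (oneS ⊕ (p ⊕ powS p 2))) n)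

  rhs : ℕ → ℕ → ℕ → Series → Series
  rhs u v w p =
    (((oneS ⊖ powS p 3) ⊛ (oneS ⊖ powS p (suc u)))
       ⊛ ((oneS ⊖ powS p (suc v)) ⊛ (oneS ⊖ powS p (suc w))))
    ⊛ invS (powS (oneS ⊖ p) 3 ⊛ (oneS ⊖ powS p (u Data.Nat.+ v Data.Nat.+ w Data.Nat.+ 3)))

-- Write D = (1 − p)³ (1 − p^(L+3)) with L = u + v + w and, for X + Y + Z = L + 3,
-- Φ(X, Y, Z) = (1 − p³)(1 − p^X)(1 − p^Y)(1 − p^Z) / D, so that the right-hand side is
-- Φ(u+1, v+1, w+1). The walk series G(q) is characterised by [t⁰] G = 1 in the orthant, G = 0 at
-- points with a coordinate −1, and [tⁿ⁺¹] G(q) = Σₛ wₛ [tⁿ] G(q + s). The series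
-- Φ(x+1, y+1, z+1) satisfies the same three conditions: the factor 1 − p⁰ = 0 kills it when a
-- coordinate is −1, and Φ = 1 + t Σₛ wₛ Φ(· + s) is a polynomial identity in p, p^x, p^y, p^z
-- and D⁻¹ modulo D · D⁻¹ = 1 and modulo the kernel (α+β) t (1 + p + p²) − p, which vanishes by
-- the choice of p. The steps preserve x + y + z, so one D serves every point of the triangle.
module Submission where

open import Level using (Level)
open import Algebra.Bundles using (CommutativeRing; Semiring)
open import Algebra.Structures using (IsCommutativeRing)
import Algebra.Construct.Pointwise as Pointwise
open import Data.Bool using (true; false; if_then_else_)
open import Data.Integer as ℤ using (ℤ; +_; -[1+_]; _◃_; ∣_∣; sign)
import Data.Integer.Properties as ℤ
open import Data.List using (List; []; _∷_; map; _++_; concatMap; applyUpTo; upTo; downFrom; zipWith)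
import Data.List.Properties as List
open import Data.Maybe using (Maybe; just; nothing)
open import Data.Nat as ℕ using (ℕ; zero; suc; pred; _∸_; _<_)
import Data.Nat.Properties as ℕ
open import Data.Nat.Tactic.RingSolver using (solve-∀)
open import Data.Product using (_×_; _,_; proj₁; proj₂)
open import Data.Sign as Sign using (Sign)
open import Relation.Binary.PropositionalEquality as ≡ using (_≡_)
open import Relation.Nullary using (yes; no)
open import Defs hiding (_⊕_; _⊖_; _⊛_)
import Defs

-- The ring solver for an arbitrary commutative ring, with ℤ as coefficient ring: natural
-- coefficients cannot express 1 − x, and coefficients in R itself would need decidable equality.
module IntegerCoefficients {c ℓ : Level} (R : CommutativeRing c ℓ) where
  open CommutativeRing R
  open import Algebra.Properties.Ring ring using (-‿involutive; -0#≈0#; -‿+-comm; -1*x≈-x; xyx⁻¹≈y)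
  open import Algebra.Properties.CommutativeSemigroup *-commutativeSemigroup using (interchange)
  open import Algebra.Properties.Semiring.Mult.TCOptimised semiring using (×-homo-+; ×1-homo-*; 1+×) renaming (_×_ to _×′_)
  open import Algebra.Solver.Ring.AlmostCommutativeRing using (fromCommutativeRing; _-Raw-AlmostCommutative⟶_)
  open import Relation.Binary.Reasoning.Setoid setoid

  fromℕ : ℕ → Carrier
  fromℕ n = n ×′ 1#

  fromℤ : ℤ → Carrier
  fromℤ (+ n) = fromℕ n
  fromℤ -[1+ n ] = - fromℕ (suc n)

  fromSign : Sign → Carrier
  fromSign Sign.+ = 1#
  fromSign Sign.- = - 1#

  fromSign-* : ∀ s t → fromSign (s Sign.* t) ≈ fromSign s * fromSign t
  fromSign-* Sign.+ t = sym (*-identityˡ _)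
  fromSign-* Sign.- Sign.+ = sym (*-identityʳ _)
  fromSign-* Sign.- Sign.- = sym (trans (-1*x≈-x (- 1#)) (-‿involutive 1#))

  fromℤ-◃ : ∀ s n → fromℤ (s ◃ n) ≈ fromSign s * fromℕ n
  fromℤ-◃ s zero = sym (zeroʳ _)
  fromℤ-◃ Sign.+ (suc n) = sym (*-identityˡ _)
  fromℤ-◃ Sign.- (suc n) = sym (-1*x≈-x _)

  fromℤ-sign : ∀ i → fromℤ i ≈ fromSign (sign i) * fromℕ ∣ i ∣
  fromℤ-sign (+ zero) = sym (zeroʳ _)
  fromℤ-sign (+ suc n) = fromℤ-◃ Sign.+ (suc n)
  fromℤ-sign -[1+ n ] = fromℤ-◃ Sign.- (suc n)

  fromℤ-* : ∀ i j → fromℤ (i ℤ.* j) ≈ fromℤ i * fromℤ j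
  fromℤ-* i j = begin
    fromℤ (i ℤ.* j)
      ≈⟨ fromℤ-◃ (sign i Sign.* sign j) (∣ i ∣ ℕ.* ∣ j ∣) ⟩
    fromSign (sign i Sign.* sign j) * fromℕ (∣ i ∣ ℕ.* ∣ j ∣)
      ≈⟨ *-cong (fromSign-* (sign i) (sign j)) (×1-homo-* ∣ i ∣ ∣ j ∣) ⟩
    (fromSign (sign i) * fromSign (sign j)) * (fromℕ ∣ i ∣ * fromℕ ∣ j ∣)
      ≈⟨ interchange _ _ _ _ ⟩
    (fromSign (sign i) * fromℕ ∣ i ∣) * (fromSign (sign j) * fromℕ ∣ j ∣)
      ≈⟨ *-cong (fromℤ-sign i) (fromℤ-sign j) ⟨
    fromℤ i * fromℤ j
      ∎

  fromℤ-⊖ : ∀ m n → fromℤ (m ℤ.⊖ n) ≈ fromℕ m - fromℕ n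
  fromℤ-⊖ m zero = sym (trans (+-congˡ -0#≈0#) (+-identityʳ _))
  fromℤ-⊖ zero (suc n) = sym (+-identityˡ _)
  fromℤ-⊖ (suc m) (suc n) = begin
    fromℤ (suc m ℤ.⊖ suc n)          ≡⟨ ≡.cong fromℤ (ℤ.[1+m]⊖[1+n]≡m⊖n m n) ⟩
    fromℤ (m ℤ.⊖ n)                  ≈⟨ fromℤ-⊖ m n ⟩
    fromℕ m - fromℕ n                ≈⟨ cancel 1# _ _ ⟨
    (1# + fromℕ m) - (1# + fromℕ n)  ≈⟨ +-cong (1+× m 1#) (-‿cong (1+× n 1#)) ⟨
    fromℕ (suc m) - fromℕ (suc n)    ∎
    where
    cancel : ∀ a x y → (a + x) - (a + y) ≈ x - y
    cancel a x y = begin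
      (a + x) - (a + y)      ≈⟨ +-congˡ (-‿+-comm a y) ⟨
      (a + x) + (- a + - y)  ≈⟨ +-assoc (a + x) (- a) (- y) ⟨
      (a + x - a) - y        ≈⟨ +-congʳ (xyx⁻¹≈y a x) ⟩
      x - y                  ∎

  fromℤ-+ : ∀ i j → fromℤ (i ℤ.+ j) ≈ fromℤ i + fromℤ j
  fromℤ-+ (+ m) (+ n) = ×-homo-+ 1# m n
  fromℤ-+ (+ m) -[1+ n ] = fromℤ-⊖ m (suc n)
  fromℤ-+ -[1+ m ] (+ n) = trans (fromℤ-⊖ n (suc m)) (+-comm _ _)
  fromℤ-+ -[1+ m ] -[1+ n ] = begin
    - fromℕ (suc (suc (m ℕ.+ n)))         ≡⟨ ≡.cong (λ k → - fromℕ (suc k)) (ℕ.+-suc m n) ⟨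
    - fromℕ (suc m ℕ.+ suc n)             ≈⟨ -‿cong (×-homo-+ 1# (suc m) (suc n)) ⟩
    - (fromℕ (suc m) + fromℕ (suc n))     ≈⟨ -‿+-comm _ _ ⟨
    - fromℕ (suc m) + - fromℕ (suc n)     ∎

  fromℤ-neg : ∀ i → fromℤ (ℤ.- i) ≈ - fromℤ i
  fromℤ-neg (+ zero) = sym -0#≈0#
  fromℤ-neg (+ suc n) = refl
  fromℤ-neg -[1+ n ] = sym (-‿involutive _)

  homomorphism : ℤ.+-*-rawRing -Raw-AlmostCommutative⟶ fromCommutativeRing R
  homomorphism = record
    { ⟦_⟧    = fromℤ
    ; +-homo = fromℤ-+
    ; *-homo = fromℤ-*
    ; -‿homo = fromℤ-neg
    ; 0-homo = refl
    ; 1-homo = refl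
    }

  coefficient≟ : ∀ i j → Maybe (fromℤ i ≈ fromℤ j)
  coefficient≟ i j with i ℤ.≟ j
  ... | yes ≡.refl = just refl
  ... | no _ = nothing

  open import Algebra.Solver.Ring ℤ.+-*-rawRing (fromCommutativeRing R) homomorphism coefficient≟ public

  0ₚ 1ₚ : ∀ {n} → Polynomial n
  0ₚ = con (+ 0)
  1ₚ = con (+ 1)

module PowerSeries {c ℓ : Level} (R : CommutativeRing c ℓ) where
  open CommutativeRing R
  open import Algebra.Definitions.RawSemiring (Semiring.rawSemiring semiring) using (_^_)
  open import Relation.Binary.Reasoning.Setoid setoid

  infix  4 _≋_
  infixl 6 _⊕_ _⊖_
  infixl 7 _⊛_

  _≋_ : Series R → Series R → Set ℓ
  f ≋ g = ∀ n → f n ≈ g n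

  _⊕_ _⊖_ _⊛_ : Series R → Series R → Series R
  _⊕_ = Defs._⊕_ R
  _⊖_ = Defs._⊖_ R
  _⊛_ = Defs._⊛_ R

  tail : Series R → Series R
  tail f n = f (suc n)

  sumBelow-cong< : ∀ {f g} n → (∀ k → k < n → f k ≈ g k) → sumBelow R f n ≈ sumBelow R g n
  sumBelow-cong< zero eq = refl
  sumBelow-cong< (suc n) eq = +-cong (sumBelow-cong< n (λ k k<n → eq k (ℕ.m<n⇒m<1+n k<n))) (eq n ℕ.≤-refl)

  sumBelow-cong : ∀ {f g} n → (∀ k → f k ≈ g k) → sumBelow R f n ≈ sumBelow R g n
  sumBelow-cong n eq = sumBelow-cong< n (λ k _ → eq k)

  sumBelow-+ : ∀ f g n → sumBelow R (λ k → f k + g k) n ≈ sumBelow R f n + sumBelow R g n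
  sumBelow-+ f g zero = sym (+-identityˡ 0#)
  sumBelow-+ f g (suc n) = trans (+-congʳ (sumBelow-+ f g n)) (interchange _ _ _ _)
    where open import Algebra.Properties.CommutativeSemigroup +-commutativeSemigroup using (interchange)

  *-distribˡ-sumBelow : ∀ a f n → a * sumBelow R f n ≈ sumBelow R (λ k → a * f k) n
  *-distribˡ-sumBelow a f zero = zeroʳ a
  *-distribˡ-sumBelow a f (suc n) = trans (distribˡ a _ _) (+-congʳ (*-distribˡ-sumBelow a f n))

  sumBelow-0 : ∀ n → sumBelow R (λ _ → 0#) n ≈ 0#
  sumBelow-0 zero = refl
  sumBelow-0 (suc n) = trans (+-identityʳ _) (sumBelow-0 n)

  sumBelow-unfoldˡ : ∀ f n → sumBelow R f (suc n) ≈ f 0 + sumBelow R (λ k → f (suc k)) n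
  sumBelow-unfoldˡ f zero = trans (+-identityˡ _) (sym (+-identityʳ _))
  sumBelow-unfoldˡ f (suc n) = trans (+-congʳ (sumBelow-unfoldˡ f n)) (+-assoc _ _ _)

  ⊛-cong : ∀ {f f′ g g′} → f ≋ f′ → g ≋ g′ → f ⊛ g ≋ f′ ⊛ g′
  ⊛-cong f≋f′ g≋g′ n = sumBelow-cong (suc n) (λ k → *-cong (f≋f′ k) (g≋g′ (n ∸ k)))

  ⊛-congʳ : ∀ g {f f′} → f ≋ f′ → f ⊛ g ≋ f′ ⊛ g
  ⊛-congʳ g f≋f′ = ⊛-cong {g = g} {g′ = g} f≋f′ (λ _ → refl)

  ⊛-at-0 : ∀ f g → (f ⊛ g) 0 ≈ f 0 * g 0
  ⊛-at-0 f g = +-identityˡ _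

  ⊛-unfoldˡ : ∀ f g n → (f ⊛ g) (suc n) ≈ f 0 * g (suc n) + (tail f ⊛ g) n
  ⊛-unfoldˡ f g n = sumBelow-unfoldˡ (λ k → f k * g (suc n ∸ k)) (suc n)

  ⊛-unfoldʳ : ∀ f g n → (f ⊛ g) (suc n) ≈ (f ⊛ tail g) n + f (suc n) * g 0
  ⊛-unfoldʳ f g n = +-cong
    (sumBelow-cong< (suc n) (λ k k<1+n → *-congˡ (reflexive (≡.cong g (ℕ.+-∸-assoc 1 (ℕ.≤-pred k<1+n))))))
    (*-congˡ (reflexive (≡.cong g (ℕ.n∸n≡0 n))))

  ⊛-zeroˡ : ∀ f g → (∀ k → f k ≈ 0#) → ∀ n → (f ⊛ g) n ≈ 0#
  ⊛-zeroˡ f g f≈0 n = trans (sumBelow-cong (suc n) (λ k → trans (*-congʳ (f≈0 k)) (zeroˡ _))) (sumBelow-0 (suc n))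

  ⊛-scaleˡ : ∀ a f g n → ((λ k → a * f k) ⊛ g) n ≈ a * (f ⊛ g) n
  ⊛-scaleˡ a f g n = trans (sumBelow-cong (suc n) (λ k → *-assoc _ _ _)) (sym (*-distribˡ-sumBelow a _ (suc n)))

  ⊛-distribʳ : ∀ h f g → (f ⊕ g) ⊛ h ≋ f ⊛ h ⊕ g ⊛ h
  ⊛-distribʳ h f g n = trans (sumBelow-cong (suc n) (λ k → distribʳ _ _ _)) (sumBelow-+ _ _ (suc n))

  ⊛-comm : ∀ f g → f ⊛ g ≋ g ⊛ f
  ⊛-comm f g zero = +-congˡ (*-comm _ _)
  ⊛-comm f g (suc n) = begin
    (f ⊛ g) (suc n)                   ≈⟨ ⊛-unfoldˡ f g n ⟩
    f 0 * g (suc n) + (tail f ⊛ g) n  ≈⟨ +-cong (*-comm _ _) (⊛-comm (tail f) g n) ⟩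
    g (suc n) * f 0 + (g ⊛ tail f) n  ≈⟨ +-comm _ _ ⟩
    (g ⊛ tail f) n + g (suc n) * f 0  ≈⟨ ⊛-unfoldʳ g f n ⟨
    (g ⊛ f) (suc n)                   ∎

  ⊛-identityˡ : ∀ f → oneS R ⊛ f ≋ f
  ⊛-identityˡ f zero = trans (⊛-at-0 (oneS R) f) (*-identityˡ _)
  ⊛-identityˡ f (suc n) = begin
    (oneS R ⊛ f) (suc n)                   ≈⟨ ⊛-unfoldˡ (oneS R) f n ⟩
    1# * f (suc n) + (tail (oneS R) ⊛ f) n ≈⟨ +-cong (*-identityˡ _) (⊛-zeroˡ (tail (oneS R)) f (λ _ → refl) n) ⟩
    f (suc n) + 0#                         ≈⟨ +-identityʳ _ ⟩
    f (suc n)                              ∎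

  ⊛-assoc : ∀ f g h → (f ⊛ g) ⊛ h ≋ f ⊛ (g ⊛ h)
  ⊛-assoc f g h zero = begin
    ((f ⊛ g) ⊛ h) 0     ≈⟨ trans (⊛-at-0 (f ⊛ g) h) (*-congʳ (⊛-at-0 f g)) ⟩
    (f 0 * g 0) * h 0   ≈⟨ *-assoc _ _ _ ⟩
    f 0 * (g 0 * h 0)   ≈⟨ trans (⊛-at-0 f (g ⊛ h)) (*-congˡ (⊛-at-0 g h)) ⟨
    (f ⊛ (g ⊛ h)) 0     ∎
  ⊛-assoc f g h (suc n) = begin
    ((f ⊛ g) ⊛ h) (suc n)
      ≈⟨ ⊛-unfoldˡ (f ⊛ g) h n ⟩
    (f ⊛ g) 0 * h (suc n) + (tail (f ⊛ g) ⊛ h) n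
      ≈⟨ +-cong (*-congʳ (⊛-at-0 f g)) (⊛-congʳ h (⊛-unfoldˡ f g) n) ⟩
    (f 0 * g 0) * h (suc n) + (((λ k → f 0 * g (suc k)) ⊕ tail f ⊛ g) ⊛ h) n
      ≈⟨ +-congˡ (trans (⊛-distribʳ h _ _ n) (+-cong (⊛-scaleˡ (f 0) (tail g) h n) (⊛-assoc (tail f) g h n))) ⟩
    (f 0 * g 0) * h (suc n) + (f 0 * (tail g ⊛ h) n + (tail f ⊛ (g ⊛ h)) n)
      ≈⟨ regroup (f 0) (g 0) _ _ _ ⟩
    f 0 * (g 0 * h (suc n) + (tail g ⊛ h) n) + (tail f ⊛ (g ⊛ h)) n
      ≈⟨ +-congʳ (*-congˡ (⊛-unfoldˡ g h n)) ⟨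
    f 0 * (g ⊛ h) (suc n) + (tail f ⊛ (g ⊛ h)) n
      ≈⟨ ⊛-unfoldˡ f (g ⊛ h) n ⟨
    (f ⊛ (g ⊛ h)) (suc n)
      ∎
    where
    regroup : ∀ a b c d e → (a * b) * c + (a * d + e) ≈ a * (b * c + d) + e
    regroup a b c d e = begin
      (a * b) * c + (a * d + e)   ≈⟨ +-assoc _ _ _ ⟨
      (a * b) * c + a * d + e     ≈⟨ +-congʳ (+-congʳ (*-assoc a b c)) ⟩
      a * (b * c) + a * d + e     ≈⟨ +-congʳ (distribˡ a _ _) ⟨
      a * (b * c + d) + e         ∎

  ⊛-identityʳ : ∀ f → f ⊛ oneS R ≋ f
  ⊛-identityʳ f n = trans (⊛-comm f (oneS R) n) (⊛-identityˡ f n)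

  ⊛-distribˡ : ∀ h f g → h ⊛ (f ⊕ g) ≋ h ⊛ f ⊕ h ⊛ g
  ⊛-distribˡ h f g n = trans (⊛-comm h (f ⊕ g) n)
                             (trans (⊛-distribʳ h f g n) (+-cong (⊛-comm f h n) (⊛-comm g h n)))

  seriesIsCommutativeRing : IsCommutativeRing _≋_ _⊕_ _⊛_ (λ f n → - f n) (λ _ → 0#) (oneS R)
  seriesIsCommutativeRing = record
    { isRing = record
      { +-isAbelianGroup = Pointwise.isAbelianGroup ℕ +-isAbelianGroup
      ; *-cong     = ⊛-cong
      ; *-assoc    = ⊛-assoc
      ; *-identity = ⊛-identityˡ , ⊛-identityʳ
      ; distrib    = ⊛-distribˡ , ⊛-distribʳ
      }
    ; *-comm = ⊛-comm
    }

  seriesRing : CommutativeRing c ℓ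
  seriesRing = record { isCommutativeRing = seriesIsCommutativeRing }

  constS-+ : ∀ a b → constS R (a + b) ≋ constS R a ⊕ constS R b
  constS-+ a b zero = refl
  constS-+ a b (suc n) = sym (+-identityˡ 0#)

  constS-⊛ : ∀ a f n → (constS R a ⊛ f) n ≈ a * f n
  constS-⊛ a f zero = ⊛-at-0 (constS R a) f
  constS-⊛ a f (suc n) = begin
    (constS R a ⊛ f) (suc n)                     ≈⟨ ⊛-unfoldˡ (constS R a) f n ⟩
    a * f (suc n) + (tail (constS R a) ⊛ f) n    ≈⟨ +-congˡ (⊛-zeroˡ (tail (constS R a)) f (λ _ → refl) n) ⟩
    a * f (suc n) + 0#                           ≈⟨ +-identityʳ _ ⟩
    a * f (suc n)                                ∎

  constS-⊛-sumList : ∀ {A : Set} (w : A → Carrier) (F : A → Series R) xs n →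
    sumList seriesRing (map (λ a → constS R (w a) ⊛ F a) xs) n ≈ sumList R (map (λ a → w a * F a n) xs)
  constS-⊛-sumList w F [] n = refl
  constS-⊛-sumList w F (x ∷ xs) n = +-cong (constS-⊛ (w x) (F x) n) (constS-⊛-sumList w F xs n)

  tS-⊛-at-0 : ∀ f → (tS R ⊛ f) 0 ≈ 0#
  tS-⊛-at-0 f = trans (⊛-at-0 (tS R) f) (zeroˡ _)

  tS-⊛-suc : ∀ f n → (tS R ⊛ f) (suc n) ≈ f n
  tS-⊛-suc f n = begin
    (tS R ⊛ f) (suc n)                  ≈⟨ ⊛-unfoldˡ (tS R) f n ⟩
    0# * f (suc n) + (tail (tS R) ⊛ f) n ≈⟨ +-cong (zeroˡ _) (⊛-congʳ f tail-tS n) ⟩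
    0# + (oneS R ⊛ f) n                 ≈⟨ trans (+-identityˡ _) (⊛-identityˡ f n) ⟩
    f n                                 ∎
    where
    tail-tS : tail (tS R) ≋ oneS R
    tail-tS zero = refl
    tail-tS (suc n) = refl

  powS-+ : ∀ f m n → powS R f (m ℕ.+ n) ≋ powS R f m ⊛ powS R f n
  powS-+ f zero n k = sym (⊛-identityˡ (powS R f n) k)
  powS-+ f (suc m) n k = trans (⊛-cong (λ _ → refl) (powS-+ f m n) k) (sym (⊛-assoc f (powS R f m) (powS R f n) k))

  powS-at-0 : ∀ f k → powS R f k 0 ≈ f 0 ^ k
  powS-at-0 f zero = refl
  powS-at-0 f (suc k) = trans (⊛-at-0 f (powS R f k)) (*-congˡ (powS-at-0 f k))

  invList≡ : ∀ f n → invList R f n ≡ map (invS R f) (downFrom (suc n))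
  invList≡ f zero = ≡.refl
  invList≡ f (suc n) = ≡.cong (invS R f (suc n) ∷_) (invList≡ f n)

  sumList-zipWith : ∀ g (b : Series R) n →
    sumList R (zipWith _*_ (applyUpTo g (suc n)) (map b (downFrom (suc n))))
      ≈ sumBelow R (λ k → g k * b (n ∸ k)) (suc n)
  sumList-zipWith g b zero = trans (+-identityʳ _) (sym (+-identityˡ _))
  sumList-zipWith g b (suc n) = trans (+-congˡ (sumList-zipWith (λ k → g (suc k)) b n))
                                      (sym (sumBelow-unfoldˡ (λ k → g k * b (suc n ∸ k)) (suc n)))

  invS-suc : ∀ f n → invS R f (suc n) ≈ - (tail f ⊛ invS R f) n
  invS-suc f n = -‿cong (begin
    sumList R (zipWith _*_ (map (λ k → f (suc k)) (upTo (suc n))) (invList R f n))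
      ≡⟨ ≡.cong₂ (λ xs ys → sumList R (zipWith _*_ xs ys))
                 (List.map-applyUpTo (λ k → k) (λ k → f (suc k)) (suc n)) (invList≡ f n) ⟩
    sumList R (zipWith _*_ (applyUpTo (λ k → f (suc k)) (suc n)) (map (invS R f) (downFrom (suc n))))
      ≈⟨ sumList-zipWith (λ k → f (suc k)) (invS R f) n ⟩
    (tail f ⊛ invS R f) n
      ∎)

  ⊛-invSʳ : ∀ f → f 0 ≈ 1# → f ⊛ invS R f ≋ oneS R
  ⊛-invSʳ f f0≈1 zero = trans (⊛-at-0 f (invS R f)) (trans (*-identityʳ _) f0≈1)
  ⊛-invSʳ f f0≈1 (suc n) = begin
    (f ⊛ invS R f) (suc n)                       ≈⟨ ⊛-unfoldˡ f (invS R f) n ⟩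
    f 0 * invS R f (suc n) + (tail f ⊛ invS R f) n ≈⟨ +-congʳ (*-cong f0≈1 (invS-suc f n)) ⟩
    1# * - (tail f ⊛ invS R f) n + (tail f ⊛ invS R f) n ≈⟨ +-congʳ (*-identityˡ _) ⟩
    - (tail f ⊛ invS R f) n + (tail f ⊛ invS R f) n ≈⟨ -‿inverseˡ _ ⟩
    0#                                           ∎

-- Applied with R the ring of power series, P = p, A = α, B = β, T = t and I the inverse of the
-- denominator.
module QuotientRecurrence {c ℓ : Level} (R : CommutativeRing c ℓ) (P I A B T : CommutativeRing.Carrier R) where
  open CommutativeRing R
  open import Algebra.Definitions.RawSemiring (Semiring.rawSemiring semiring) using (_^_)
  open IntegerCoefficients R
  open import Relation.Binary.Reasoning.Setoid setoid

  quotient : Carrier → Carrier → Carrier → Carrier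
  quotient X Y Z = (((1# - P ^ 3) * (1# - X)) * ((1# - Y) * (1# - Z))) * I

  neighbours : Carrier → Carrier → Carrier → Carrier
  neighbours X Y Z =
    A * quotient (P * (P * X)) (P * Y) Z + (A * quotient X (P * (P * Y)) (P * Z) +
    (A * quotient (P * X) Y (P * (P * Z)) + (B * quotient (P * (P * X)) Y (P * Z) +
    (B * quotient X (P * Y) (P * (P * Z)) + (B * quotient (P * X) (P * (P * Y)) Z + 0#)))))

  kernel : Carrier
  kernel = (A + B) * T * (1# + (P + P ^ 2)) - P

  denominator : Carrier → Carrier → Carrier → Carrier
  denominator X Y Z = (1# - P) ^ 3 * (1# - (P * X) * (P * Y) * (P * Z))

  cofactor : Carrier → Carrier → Carrier → Carrier
  cofactor X Y Z = (1# - P ^ 3) * (X + Y + Z - P * (X * Y + Y * Z + Z * X))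
                   - (1# + 1# + 1#) * (1# - P) * (1# - (P * X) * (P * Y) * (P * Z))

  -- Solver syntax for quotient and, inside expansion, for the other definitions above;
  -- `solve … refl` relies on these evaluating to them definitionally.
  private
    quotientₚ : ∀ {n} → (P I X Y Z : Polynomial n) → Polynomial n
    quotientₚ P I X Y Z = (((1ₚ :- P :^ 3) :* (1ₚ :- X)) :* ((1ₚ :- Y) :* (1ₚ :- Z))) :* I

  -- Up to the common factor I this is (1 − P³)(N − T Σ) = denominator X Y Z + kernel · cofactor X Y Z,
  -- where N = (1 − PX)(1 − PY)(1 − PZ) and Σ is neighbours without the factors (1 − P³) and I:
  -- the product N obeys the walk recurrence modulo the kernel.
  expansion : ∀ X Y Z → quotient (P * X) (P * Y) (P * Z) ≈
    1# + T * neighbours X Y Z + (denominator X Y Z * I - 1#) + kernel * (cofactor X Y Z * I)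
  expansion X Y Z = solve 8
    (λ P I A B T X Y Z →
      let quotient′ : Polynomial 8 → Polynomial 8 → Polynomial 8 → Polynomial 8
          quotient′ = quotientₚ P I
          neighboursₚ : Polynomial 8
          neighboursₚ =
            A :* quotient′ (P :* (P :* X)) (P :* Y) Z :+ (A :* quotient′ X (P :* (P :* Y)) (P :* Z) :+
            (A :* quotient′ (P :* X) Y (P :* (P :* Z)) :+ (B :* quotient′ (P :* (P :* X)) Y (P :* Z) :+
            (B :* quotient′ X (P :* Y) (P :* (P :* Z)) :+ (B :* quotient′ (P :* X) (P :* (P :* Y)) Z :+ 0ₚ)))))
          kernelₚ : Polynomial 8
          kernelₚ = (A :+ B) :* T :* (1ₚ :+ (P :+ P :^ 2)) :- P
          denominatorₚ : Polynomial 8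
          denominatorₚ = (1ₚ :- P) :^ 3 :* (1ₚ :- (P :* X) :* (P :* Y) :* (P :* Z))
          cofactorₚ : Polynomial 8
          cofactorₚ = (1ₚ :- P :^ 3) :* (X :+ Y :+ Z :- P :* (X :* Y :+ Y :* Z :+ Z :* X))
                      :- (1ₚ :+ 1ₚ :+ 1ₚ) :* (1ₚ :- P) :* (1ₚ :- (P :* X) :* (P :* Y) :* (P :* Z))
      in quotient′ (P :* X) (P :* Y) (P :* Z)
           := 1ₚ :+ T :* neighboursₚ :+ (denominatorₚ :* I :- 1ₚ) :+ kernelₚ :* (cofactorₚ :* I))
    refl P I A B T X Y Z

  quotient-recurrence : kernel ≈ 0# → ∀ X Y Z → denominator X Y Z * I ≈ 1# →
    quotient (P * X) (P * Y) (P * Z) ≈ 1# + T * neighbours X Y Z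
  quotient-recurrence kernel≈0 X Y Z D*I≈1 = begin
    quotient (P * X) (P * Y) (P * Z)
      ≈⟨ expansion X Y Z ⟩
    1# + T * neighbours X Y Z + (denominator X Y Z * I - 1#) + kernel * (cofactor X Y Z * I)
      ≈⟨ +-cong (+-congˡ (+-congʳ D*I≈1)) (*-congʳ kernel≈0) ⟩
    1# + T * neighbours X Y Z + (1# - 1#) + 0# * (cofactor X Y Z * I)
      ≈⟨ solve 2 (λ N K → N :+ (1ₚ :- 1ₚ) :+ 0ₚ :* K := N) refl _ _ ⟩
    1# + T * neighbours X Y Z
      ∎

  quotient-vanishes₁ : ∀ Y Z → quotient 1# Y Z ≈ 0#
  quotient-vanishes₁ = solve 4 (λ P I Y Z → quotientₚ P I 1ₚ Y Z := 0ₚ) refl P I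

  quotient-vanishes₂ : ∀ X Z → quotient X 1# Z ≈ 0#
  quotient-vanishes₂ = solve 4 (λ P I X Z → quotientₚ P I X 1ₚ Z := 0ₚ) refl P I

  quotient-vanishes₃ : ∀ X Y → quotient X Y 1# ≈ 0#
  quotient-vanishes₃ = solve 4 (λ P I X Y → quotientₚ P I X Y 1ₚ := 0ₚ) refl P I

module Walks {c ℓ : Level} (R : CommutativeRing c ℓ) (α β : CommutativeRing.Carrier R) where
  open CommutativeRing R
  open import Relation.Binary.Reasoning.Setoid setoid

  sumList-++ : ∀ xs ys → sumList R (xs ++ ys) ≈ sumList R xs + sumList R ys
  sumList-++ [] ys = sym (+-identityˡ _)
  sumList-++ (x ∷ xs) ys = trans (+-congˡ (sumList-++ xs ys)) (sym (+-assoc _ _ _))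

  sumList-map-cong : ∀ {A : Set} {f g : A → Carrier} → (∀ a → f a ≈ g a) →
                     ∀ xs → sumList R (map f xs) ≈ sumList R (map g xs)
  sumList-map-cong f≈g [] = refl
  sumList-map-cong f≈g (x ∷ xs) = +-cong (f≈g x) (sumList-map-cong f≈g xs)

  *-distribˡ-sumList : ∀ {A : Set} a (f : A → Carrier) xs →
                       a * sumList R (map f xs) ≈ sumList R (map (λ x → a * f x) xs)
  *-distribˡ-sumList a f [] = zeroʳ a
  *-distribˡ-sumList a f (x ∷ xs) = trans (distribˡ a _ _) (+-congˡ (*-distribˡ-sumList a f xs))

  sumList-0 : ∀ {A : Set} (xs : List A) → sumList R (map (λ _ → 0#) xs) ≈ 0#
  sumList-0 [] = refl
  sumList-0 (x ∷ xs) = trans (+-identityˡ _) (sumList-0 xs)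

  contribution : Point → List Step → Carrier
  contribution q ω = if stays q ω then prodList R (map (weight R α β) ω) else 0#

  G : Point → Series R
  G q n = sumList R (map (contribution q) (walksOfLength n))

  stays-outside : ∀ {q} → inOrthant q ≡ false → ∀ ω → stays q ω ≡ false
  stays-outside q∉ [] = q∉
  stays-outside q∉ (s ∷ ω) rewrite q∉ = ≡.refl

  G-outside : ∀ {q} → inOrthant q ≡ false → ∀ n → G q n ≈ 0#
  G-outside {q} q∉ n = trans (sumList-map-cong vanishes (walksOfLength n)) (sumList-0 (walksOfLength n))
    where
    vanishes : ∀ ω → contribution q ω ≈ 0#
    vanishes ω with stays q ω | stays-outside {q} q∉ ω
    ... | _ | ≡.refl = refl

  G-at-0 : ∀ {q} → inOrthant q ≡ true → G q 0 ≈ 1#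
  G-at-0 q∈ rewrite q∈ = +-identityʳ 1#

  contribution-∷ : ∀ {q} → inOrthant q ≡ true →
                   ∀ s ω → contribution q (s ∷ ω) ≈ weight R α β s * contribution (move q s) ω
  contribution-∷ {q} q∈ s ω rewrite q∈ with stays (move q s) ω
  ... | true = refl
  ... | false = sym (zeroʳ _)

  weightedSum : (Step → Carrier) → Carrier
  weightedSum f = sumList R (map (λ s → weight R α β s * f s) allSteps)

  weightedSum-cong : ∀ f g → (∀ s → f s ≈ g s) → weightedSum f ≈ weightedSum g
  weightedSum-cong f g f≈g =
    sumList-map-cong {f = λ s → weight R α β s * f s} {g = λ s → weight R α β s * g s} (λ s → *-congˡ (f≈g s)) allSteps

  G-suc : ∀ {q} → inOrthant q ≡ true → ∀ n → G q (suc n) ≈ weightedSum (λ s → G (move q s) n)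
  G-suc {q} q∈ n = by-first-step allSteps
    where
    W : List (List Step)
    W = walksOfLength n

    starting-with : ∀ s → sumList R (map (contribution q) (map (s ∷_) W)) ≈ weight R α β s * G (move q s) n
    starting-with s = begin
      sumList R (map (contribution q) (map (s ∷_) W))                 ≡⟨ ≡.cong (sumList R) (List.map-∘ W) ⟨
      sumList R (map (λ ω → contribution q (s ∷ ω)) W)                ≈⟨ sumList-map-cong (contribution-∷ {q} q∈ s) W ⟩
      sumList R (map (λ ω → weight R α β s * contribution (move q s) ω) W) ≈⟨ *-distribˡ-sumList _ _ W ⟨
      weight R α β s * G (move q s) n                                 ∎

    by-first-step : ∀ ss → sumList R (map (contribution q) (concatMap (λ s → map (s ∷_) W) ss))
                             ≈ sumList R (map (λ s → weight R α β s * G (move q s) n) ss)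
    by-first-step [] = refl
    by-first-step (s ∷ ss) = begin
      sumList R (map (contribution q) (map (s ∷_) W ++ concatMap (λ s → map (s ∷_) W) ss))
        ≡⟨ ≡.cong (sumList R) (List.map-++ (contribution q) (map (s ∷_) W) _) ⟩
      sumList R (map (contribution q) (map (s ∷_) W) ++ map (contribution q) (concatMap (λ s → map (s ∷_) W) ss))
        ≈⟨ trans (sumList-++ (map (contribution q) (map (s ∷_) W)) _) (+-cong (starting-with s) (by-first-step ss)) ⟩
      weight R α β s * G (move q s) n + sumList R (map (λ s → weight R α β s * G (move q s) n) ss)
        ∎

+-suc³ : ∀ x y z → x ℕ.+ y ℕ.+ z ℕ.+ 3 ≡ suc x ℕ.+ suc y ℕ.+ suc z
+-suc³ = solve-∀

ℕ³ : Set
ℕ³ = ℕ × ℕ × ℕ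

size : ℕ³ → ℕ
size (x , y , z) = x ℕ.+ y ℕ.+ z

point : ℕ³ → Point
point (x , y , z) = (+ x , + y , + z)

exponents : ℕ³ → ℕ³
exponents (x , y , z) = (suc x , suc y , suc z)

-- A step acting on the exponent triple (x+1, y+1, z+1) of the point (x, y, z); the exponents are
-- positive, so pred never truncates.
shift : Step → ℕ³ → ℕ³
shift a₁ (X , Y , Z) = (suc X , Y , pred Z)
shift a₂ (X , Y , Z) = (pred X , suc Y , Z)
shift a₃ (X , Y , Z) = (X , pred Y , suc Z)
shift b₁ (X , Y , Z) = (suc X , pred Y , Z)
shift b₂ (X , Y , Z) = (pred X , Y , suc Z)
shift b₃ (X , Y , Z) = (X , suc Y , pred Z)

data HasZero : ℕ³ → Set where
  zero₁ : ∀ {Y Z} → HasZero (0 , Y , Z)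
  zero₂ : ∀ {X Z} → HasZero (X , 0 , Z)
  zero₃ : ∀ {X Y} → HasZero (X , Y , 0)

data Landing (s : Step) (q : ℕ³) : Set where
  inside  : ∀ q′ → move (point q) s ≡ point q′ → shift s (exponents q) ≡ exponents q′ →
            size q′ ≡ size q → Landing s q
  outside : inOrthant (move (point q) s) ≡ false → HasZero (shift s (exponents q)) → Landing s q

triple-≡ : ∀ {a a′ b b′ c c′ : ℤ} → a ≡ a′ → b ≡ b′ → c ≡ c′ → (a , b , c) ≡ (a′ , b′ , c′)
triple-≡ ≡.refl ≡.refl ≡.refl = ≡.refl

landing : ∀ s q → Landing s q
landing a₁ (x , y , zero)  = outside ≡.refl zero₃
landing a₁ (x , y , suc z) = inside (suc x , y , z)
  (triple-≡ (ℤ.+-comm (+ x) (+ 1)) (ℤ.+-identityʳ (+ y)) ≡.refl) ≡.refl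
  (≡.sym (ℕ.+-suc (x ℕ.+ y) z))
landing a₂ (zero , y , z)  = outside ≡.refl zero₁
landing a₂ (suc x , y , z) = inside (x , suc y , z)
  (triple-≡ ≡.refl (ℤ.+-comm (+ y) (+ 1)) (ℤ.+-identityʳ (+ z))) ≡.refl
  (≡.cong (ℕ._+ z) (ℕ.+-suc x y))
landing a₃ (x , zero , z)  = outside ≡.refl zero₂
landing a₃ (x , suc y , z) = inside (x , y , suc z)
  (triple-≡ (ℤ.+-identityʳ (+ x)) ≡.refl (ℤ.+-comm (+ z) (+ 1))) ≡.refl
  (≡.trans (ℕ.+-suc (x ℕ.+ y) z) (≡.cong (ℕ._+ z) (≡.sym (ℕ.+-suc x y))))
landing b₁ (x , zero , z)  = outside ≡.refl zero₂
landing b₁ (x , suc y , z) = inside (suc x , y , z)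
  (triple-≡ (ℤ.+-comm (+ x) (+ 1)) ≡.refl (ℤ.+-identityʳ (+ z))) ≡.refl
  (≡.cong (ℕ._+ z) (≡.sym (ℕ.+-suc x y)))
landing b₂ (zero , y , z)  = outside ≡.refl zero₁
landing b₂ (suc x , y , z) = inside (x , y , suc z)
  (triple-≡ ≡.refl (ℤ.+-identityʳ (+ y)) (ℤ.+-comm (+ z) (+ 1))) ≡.refl
  (ℕ.+-suc (x ℕ.+ y) z)
landing b₃ (x , y , zero)  = outside ≡.refl zero₃
landing b₃ (x , y , suc z) = inside (x , suc y , z)
  (triple-≡ (ℤ.+-identityʳ (+ x)) (ℤ.+-comm (+ y) (+ 1)) ≡.refl) ≡.refl
  (≡.trans (≡.cong (ℕ._+ z) (ℕ.+-suc x y)) (≡.sym (ℕ.+-suc (x ℕ.+ y) z)))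

module GeneratingFunction {c ℓ : Level} (R : CommutativeRing c ℓ) (α β : CommutativeRing.Carrier R)
                (p : Series R) (isP : IsP R α β p) (L : ℕ) where
  open CommutativeRing R
  open import Algebra.Definitions.RawSemiring (Semiring.rawSemiring semiring) using (_^_)
  open import Algebra.Properties.Semiring.Exp semiring using (^-congˡ)
  open import Relation.Binary.Reasoning.Setoid setoid
  open IntegerCoefficients R using (solve; _:=_; _:*_; _:-_; _:^_; 0ₚ; 1ₚ)
  open PowerSeries R
  open Walks R α β
  private module 𝕊 = CommutativeRing seriesRing

  denominatorSeries : Series R
  denominatorSeries = powS R (oneS R ⊖ p) 3 ⊛ (oneS R ⊖ powS R p (L ℕ.+ 3))

  inverse : Series R
  inverse = invS R denominatorSeries

  open QuotientRecurrence seriesRing p inverse (constS R α) (constS R β) (tS R)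

  Φ : ℕ³ → Series R
  Φ (X , Y , Z) = quotient (powS R p X) (powS R p Y) (powS R p Z)

  denominatorSeries-at-0 : denominatorSeries 0 ≈ 1#
  denominatorSeries-at-0 = begin
    denominatorSeries 0
      ≈⟨ ⊛-at-0 (powS R (oneS R ⊖ p) 3) (oneS R ⊖ powS R p (L ℕ.+ 3)) ⟩
    powS R (oneS R ⊖ p) 3 0 * (1# - powS R p (L ℕ.+ 3) 0)
      ≈⟨ *-cong (powS-at-0 (oneS R ⊖ p) 3) (+-congˡ (-‿cong (powS-at-0 p (L ℕ.+ 3)))) ⟩
    (1# - p 0) ^ 3 * (1# - p 0 ^ (L ℕ.+ 3))
      ≡⟨ ≡.cong (λ k → (1# - p 0) ^ 3 * (1# - p 0 ^ k)) (ℕ.+-comm L 3) ⟩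
    (1# - p 0) ^ 3 * (1# - p 0 * p 0 ^ (2 ℕ.+ L))
      ≈⟨ *-cong (^-congˡ 3 (+-congˡ (-‿cong (proj₁ isP)))) (+-congˡ (-‿cong (*-congʳ (proj₁ isP)))) ⟩
    (1# - 0#) ^ 3 * (1# - 0# * p 0 ^ (2 ℕ.+ L))
      ≈⟨ solve 1 (λ z → (1ₚ :- 0ₚ) :^ 3 :* (1ₚ :- 0ₚ :* z) := 1ₚ) refl _ ⟩
    1#
      ∎

  kernel≈0 : kernel 𝕊.≈ 𝕊.0#
  kernel≈0 = 𝕊.trans (𝕊.+-congʳ (𝕊.sym p≈)) (𝕊.-‿inverseʳ p)
    where
    p≈ : p 𝕊.≈ (constS R α 𝕊.+ constS R β) 𝕊.* tS R 𝕊.* (𝕊.1# 𝕊.+ (p 𝕊.+ powS R p 2))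
    p≈ n = trans (proj₂ isP n) (⊛-congʳ (oneS R ⊕ (p ⊕ powS R p 2)) (⊛-congʳ (tS R) (constS-+ α β)) n)

  -- At E = exponents (x , y , z) this unfolds to neighbours (powS R p x) (powS R p y) (powS R p z).
  stepSeries : ℕ³ → Series R
  stepSeries E = sumList seriesRing (map (λ s → constS R (weight R α β s) ⊛ Φ (shift s E)) allSteps)

  Φ-recurrence : ∀ q → size q ≡ L → Φ (exponents q) ≋ oneS R ⊕ tS R ⊛ stepSeries (exponents q)
  Φ-recurrence (x , y , z) sum≡L = quotient-recurrence kernel≈0 (powS R p x) (powS R p y) (powS R p z)
    (λ n → trans (⊛-congʳ inverse (λ k → sym (denominator-split k)) n)
                 (⊛-invSʳ denominatorSeries denominatorSeries-at-0 n))
    where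
    pˣ pʸ pᶻ : Series R
    pˣ = powS R p (suc x)
    pʸ = powS R p (suc y)
    pᶻ = powS R p (suc z)

    powS-split : powS R p (L ℕ.+ 3) ≋ pˣ ⊛ pʸ ⊛ pᶻ
    powS-split k = begin
      powS R p (L ℕ.+ 3) k                      ≡⟨ ≡.cong (λ m → powS R p m k) exponent-split ⟩
      powS R p (suc x ℕ.+ suc y ℕ.+ suc z) k    ≈⟨ powS-+ p (suc x ℕ.+ suc y) (suc z) k ⟩
      (powS R p (suc x ℕ.+ suc y) ⊛ pᶻ) k       ≈⟨ ⊛-congʳ pᶻ (powS-+ p (suc x) (suc y)) k ⟩
      (pˣ ⊛ pʸ ⊛ pᶻ) k                          ∎
      where
      exponent-split : L ℕ.+ 3 ≡ suc x ℕ.+ suc y ℕ.+ suc z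
      exponent-split = ≡.trans (≡.cong (ℕ._+ 3) (≡.sym sum≡L)) (+-suc³ x y z)

    denominator-split : denominatorSeries ≋ denominator (powS R p x) (powS R p y) (powS R p z)
    denominator-split = ⊛-cong {g = oneS R ⊖ powS R p (L ℕ.+ 3)} {g′ = oneS R ⊖ pˣ ⊛ pʸ ⊛ pᶻ}
      (λ _ → refl) (λ n → +-congˡ (-‿cong (powS-split n)))

  Φ-vanishes : ∀ {E} → HasZero E → ∀ n → Φ E n ≈ 0#
  Φ-vanishes (zero₁ {Y} {Z}) = quotient-vanishes₁ (powS R p Y) (powS R p Z)
  Φ-vanishes (zero₂ {X} {Z}) = quotient-vanishes₂ (powS R p X) (powS R p Z)
  Φ-vanishes (zero₃ {X} {Y}) = quotient-vanishes₃ (powS R p X) (powS R p Y)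

  Φ-at-0 : ∀ q → size q ≡ L → Φ (exponents q) 0 ≈ 1#
  Φ-at-0 q sum≡L = begin
    Φ (exponents q) 0                              ≈⟨ Φ-recurrence q sum≡L 0 ⟩
    1# + (tS R ⊛ stepSeries (exponents q)) 0       ≈⟨ +-congˡ (tS-⊛-at-0 (stepSeries (exponents q))) ⟩
    1# + 0#                                        ≈⟨ +-identityʳ 1# ⟩
    1#                                             ∎

  Φ-at-suc : ∀ q → size q ≡ L → ∀ n →
             Φ (exponents q) (suc n) ≈ weightedSum (λ s → Φ (shift s (exponents q)) n)
  Φ-at-suc q sum≡L n = begin
    Φ (exponents q) (suc n)                        ≈⟨ Φ-recurrence q sum≡L (suc n) ⟩
    0# + (tS R ⊛ stepSeries (exponents q)) (suc n) ≈⟨ +-identityˡ _ ⟩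
    (tS R ⊛ stepSeries (exponents q)) (suc n)      ≈⟨ tS-⊛-suc (stepSeries (exponents q)) n ⟩
    stepSeries (exponents q) n
      ≈⟨ constS-⊛-sumList (weight R α β) (λ s → Φ (shift s (exponents q))) allSteps n ⟩
    weightedSum (λ s → Φ (shift s (exponents q)) n)
      ∎

  G≈Φ : ∀ n q → size q ≡ L → G (point q) n ≈ Φ (exponents q) n
  G≈Φ zero q sum≡L = trans (G-at-0 {point q} ≡.refl) (sym (Φ-at-0 q sum≡L))
  G≈Φ (suc n) q sum≡L = begin
    G (point q) (suc n)
      ≈⟨ G-suc {point q} ≡.refl n ⟩
    weightedSum (λ s → G (move (point q) s) n)
      ≈⟨ weightedSum-cong _ _ (λ s → after-step s (landing s q)) ⟩
    weightedSum (λ s → Φ (shift s (exponents q)) n)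
      ≈⟨ Φ-at-suc q sum≡L n ⟨
    Φ (exponents q) (suc n)
      ∎
    where
    after-step : ∀ s → Landing s q → G (move (point q) s) n ≈ Φ (shift s (exponents q)) n
    after-step s (inside q′ moved shifted same-size) rewrite moved | shifted =
      G≈Φ n q′ (≡.trans same-size sum≡L)
    after-step s (outside out has-zero) = trans (G-outside out n) (sym (Φ-vanishes has-zero n))

theorem3 : {c ℓ : Level} (R : CommutativeRing c ℓ) (α β : CommutativeRing.Carrier R)
    (u v w : ℕ) (p : Series R) → IsP R α β p →
    (n : ℕ) → CommutativeRing._≈_ R (Gcoeff R α β u v w n) (rhs R u v w p n)
theorem3 R α β u v w p isP n = GeneratingFunction.G≈Φ R α β p isP (u ℕ.+ v ℕ.+ w) n (u , v , w) ≡.refl
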